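{- Let $k>2$ be an integer. Let $p_1<p_2<p_3<\cdots$ be the elements of $\widehat{P}$ in increasing order, with $a_i=H(p_i)$ (so $a_1<a_2<\cdots$; e.g. $(p_1,a_1)=(3,2)$, $(p_2,a_2)=(7,3)$, $(p_3,a_3)=(19,4)$, $(p_4,a_4)=(163,6)$), and let $r$ be the largest index with $a_r\le k$. Then the largest odd elements of $C_k$, in decreasing order, are $$3^{k-1},\ 3^{k-a_2}p_2,\ 3^{k-a_3}p_3,\ \dots,\ 3^{k-a_r}p_r;$$ that is, these $r$ numbers are odd, strictly decreasing, lie in $C_k$, and every other odd element of $C_k$ is smaller than $3^{k-a_r}p_r$.
   Context: Let $\varphi$ be Euler's totient function. The height function $H$ on positive integers is defined by $H(1)=0$ and $H(n)=H(\varphi(n))+1$ for $n\ge 2$, and $C_k=\{n : H(n)=k\}$. Let $\widehat{P}$ be the set of primes $p$ such that $p=2\cdot 3^{j-2}+1$ for some integer $j\ge 2$. -}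

module Defs where

open import Data.Nat using (ℕ; zero; suc; _+_; _*_; _∸_; _^_; _≤_; _<_; _≤?_; _≟_)
open import Data.Nat.GCD using (gcd)
open import Data.Nat.Primality using (Prime)
open import Data.Nat.Divisibility using (_∣_)
open import Data.List using (List; length; filter; map; upTo)
open import Data.Product using (Σ; _×_)
open import Relation.Nullary using (¬_; yes; no)
open import Relation.Binary.PropositionalEquality using (_≡_)

φ : ℕ → ℕ
φ n = length (filter (λ m → gcd m n ≟ 1) (map suc (upTo n)))

-- Height with fuel: iterate φ until reaching a value ≤ 1, counting steps.
-- Since φ n < n for n ≥ 2, fuel n suffices for argument n.
Hfuel : ℕ → ℕ → ℕ
Hfuel zero n = 0
Hfuel (suc f) n with n ≤? 1
... | yes _ = 0
... | no _ = suc (Hfuel f (φ n))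

-- H 1 = 0 and H n = H (φ n) + 1 for n ≥ 2  (H 0 = 0 is a harmless artefact; 0 is not a positive integer)
H : ℕ → ℕ
H n = Hfuel n n

C : ℕ → ℕ → Set
C k n = 1 ≤ n × H n ≡ k

Odd : ℕ → Set
Odd n = ¬ (2 ∣ n)

P̂ : ℕ → Set
P̂ p = Prime p × Σ ℕ (λ j → 2 ≤ j × p ≡ 2 * 3 ^ (j ∸ 2) + 1)

val : ℕ → ℕ → ℕ
val k p = 3 ^ (k ∸ H p) * p

{-# OPTIONS --safe #-}
-- Let F be Shapiro's completely additive function with F 2 = 1 and F p = F (p - 1) for odd
-- primes p.  Since φ (p m) is p φ m or (p - 1) φ m, φ lowers F by one on even numbers and
-- preserves it on odd ones; as φ n is even for n ≥ 3, this gives H n = F n for even n and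
-- H n = F n + 1 for odd n ≥ 2.  So the odd elements of C k are the odd n with F n = k - 1.
-- Induction along prime factorisations shows that a number n with F n = v is 3^v, 2·3^c, or
-- 3^a p with p = 2·3^c + 1 prime, or else n ≤ (2/3)·3^v.  For odd n the first and third
-- cases are exactly the numbers 3^(k - H p) p with p ∈ P̂, and in the last case
-- n ≤ 2·3^(k-2) < 2·3^(k-2) + 3^(k - H p) = 3^(k - H p) p.
module Submission where

open import Defs
open import Data.Bool using (Bool; true; false; _∧_; not)
open import Data.Bool.Properties using (∧-identityʳ; ∧-zeroʳ)
open import Data.Empty using (⊥-elim)
open import Data.List using (_∷_; length; filter; map; upTo; applyUpTo)
open import Data.List.Properties using (map-upTo)
open import Data.List.Relation.Unary.All using (All; []; _∷_)
open import Data.Nat using (ℕ; zero; suc; _+_; _*_; _∸_; _^_; _≤_; _<_; z≤n; s≤s; NonZero)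
open import Data.Nat.Base using (>-nonZero; nonTrivial⇒n>1)
open import Data.Nat.Coprimality using (Coprime; coprime?; coprime-+; coprime-divisor; gcd≡1⇒coprime; coprime⇒gcd≡1)
open import Data.Nat.Divisibility
open import Data.Nat.GCD using (gcd)
open import Data.Nat.Induction using (<-rec)
open import Data.Nat.ListAction using (product)
open import Data.Nat.Primality
  using (Prime; prime?; prime[2]; ¬prime[1]; euclidsLemma; prime⇒irreducible; prime⇒nonTrivial; prime⇒nonZero; productOfPrimes≥1)
open import Data.Nat.Primality.Factorisation using (factorise; PrimeFactorisation)
open import Data.Nat.Properties
open import Algebra.Properties.CommutativeSemigroup *-commutativeSemigroup
  using () renaming (interchange to *-interchange; x∙yz≈y∙xz to *-swap)
open import Data.Nat.Tactic.RingSolver using (solve-∀)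
open import Data.Product using (Σ; _×_; _,_; proj₁; proj₂)
open import Data.Sum using (_⊎_; inj₁; inj₂)
open import Function using (_∘_; _⇔_; mk⇔; Equivalence)
open import Relation.Nullary using (¬_; yes; no; does; _×-dec_; ¬?)
open import Relation.Nullary.Decidable using (dec-true; dec-false; does-⇔; toWitness)
open import Relation.Unary using (Decidable)
open import Relation.Binary.PropositionalEquality

indicator : Bool → ℕ
indicator true  = 1
indicator false = 0

count : (ℕ → Bool) → ℕ → ℕ
count Q zero    = 0
count Q (suc N) = indicator (Q 0) + count (Q ∘ suc) N

count-cong : ∀ {Q R} → (∀ i → Q i ≡ R i) → ∀ N → count Q N ≡ count R N
count-cong Q≗R zero    = refl
count-cong Q≗R (suc N) = cong₂ _+_ (cong indicator (Q≗R 0)) (count-cong (Q≗R ∘ suc) N)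

count-+ : ∀ Q N M → count Q (N + M) ≡ count Q N + count (λ i → Q (N + i)) M
count-+ Q zero    M = refl
count-+ Q (suc N) M = trans (cong (indicator (Q 0) +_) (count-+ (Q ∘ suc) N M))
                            (sym (+-assoc (indicator (Q 0)) _ _))

count-suc : ∀ Q N → count Q (suc N) ≡ count Q N + indicator (Q N)
count-suc Q zero    = +-comm (indicator (Q 0)) 0
count-suc Q (suc N) = trans (cong (indicator (Q 0) +_) (count-suc (Q ∘ suc) N))
                            (sym (+-assoc (indicator (Q 0)) _ _))

count-periodic : ∀ Q m → (∀ i → Q (m + i) ≡ Q i) → ∀ j → count Q (j * m) ≡ j * count Q m
count-periodic Q m per zero    = refl
count-periodic Q m per (suc j) =
  trans (count-+ Q m (j * m)) (cong (count Q m +_) (trans (count-cong per (j * m)) (count-periodic Q m per j)))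

count-partition : ∀ Q R N → count Q N ≡ count (λ i → Q i ∧ R i) N + count (λ i → Q i ∧ not (R i)) N
count-partition Q R zero = refl
count-partition Q R (suc N) with Q 0 | R 0 | count-partition (Q ∘ suc) (R ∘ suc) N
... | true  | true  | ih = cong suc ih
... | true  | false | ih = trans (cong suc ih) (sym (+-suc _ _))
... | false | _     | ih = ih

count-none : ∀ Q N → (∀ i → i < N → Q i ≡ false) → count Q N ≡ 0
count-none Q zero    none = refl
count-none Q (suc N) none rewrite none 0 (s≤s z≤n) = count-none (Q ∘ suc) N (λ i i<N → none (suc i) (s≤s i<N))

count-≤ : ∀ Q N → count Q N ≤ N
count-≤ Q zero = z≤n
count-≤ Q (suc N) with Q 0
... | true  = s≤s (count-≤ (Q ∘ suc) N)
... | false = m≤n⇒m≤1+n (count-≤ (Q ∘ suc) N)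

∣-+-self⇔ : ∀ {p x} → p ∣ p + x ⇔ p ∣ x
∣-+-self⇔ = mk⇔ (λ p∣p+x → ∣m+n∣m⇒∣n p∣p+x ∣-refl) (∣m∣n⇒∣m+n ∣-refl)

module _ (q : ℕ) where
  private
    p = suc q
    Q : (ℕ → Bool) → ℕ → Bool
    Q S i = S (suc i) ∧ does (p ∣? suc i)

  count-multiples-block : ∀ S → count (Q S) p ≡ indicator (S p)
  count-multiples-block S = begin
    count (Q S) (suc q)                  ≡⟨ count-suc (Q S) q ⟩
    count (Q S) q + indicator (Q S q)    ≡⟨ cong (_+ indicator (Q S q)) (count-none (Q S) q below-p) ⟩
    indicator (S p ∧ does (p ∣? p))      ≡⟨ cong (λ b → indicator (S p ∧ b)) (dec-true (p ∣? p) ∣-refl) ⟩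
    indicator (S p ∧ true)               ≡⟨ cong indicator (∧-identityʳ (S p)) ⟩
    indicator (S p)                      ∎
    where
    open ≡-Reasoning
    below-p : ∀ i → i < q → Q S i ≡ false
    below-p i i<q = trans (cong (S (suc i) ∧_) (dec-false (p ∣? suc i) (λ p∣ → <⇒≱ (s≤s i<q) (∣⇒≤ p∣))))
                          (∧-zeroʳ (S (suc i)))

  count-multiples : ∀ S N → count (Q S) (p * N) ≡ count (λ i → S (p * suc i)) N
  count-multiples S zero rewrite *-zeroʳ q = refl
  count-multiples S (suc N) = begin
    count (Q S) (p * suc N)                            ≡⟨ cong (count (Q S)) (*-suc p N) ⟩
    count (Q S) (p + p * N)                            ≡⟨ count-+ (Q S) p (p * N) ⟩
    count (Q S) p + count (λ i → Q S (p + i)) (p * N)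
                                                       ≡⟨ cong₂ _+_ (count-multiples-block S) (count-cong shift (p * N)) ⟩
    indicator (S p) + count (Q S′) (p * N)             ≡⟨ cong (indicator (S p) +_) (count-multiples S′ N) ⟩
    indicator (S p) + count (λ i → S′ (p * suc i)) N   ≡⟨ cong₂ _+_ (cong (indicator ∘ S) (sym (*-identityʳ p)))
                                                                    (count-cong (λ i → cong S (sym (*-suc p (suc i)))) N) ⟩
    count (λ i → S (p * suc i)) (suc N)                ∎
    where
    open ≡-Reasoning
    S′ = S ∘ (p +_)
    shift : ∀ i → Q S (p + i) ≡ Q S′ i
    shift i = trans (cong (λ x → S x ∧ does (p ∣? x)) (sym (+-suc p i)))
                    (cong (S′ (suc i) ∧_) (does-⇔ ∣-+-self⇔ (p ∣? p + suc i) (p ∣? suc i)))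

coprime-∣ˡ : ∀ {x y n} → Coprime x n → y ∣ x → Coprime y n
coprime-∣ˡ c y∣x (d∣y , d∣n) = c (∣-trans d∣y y∣x , d∣n)

coprime-∣ʳ : ∀ {x m n} → Coprime x n → m ∣ n → Coprime x m
coprime-∣ʳ c m∣n (d∣x , d∣m) = c (d∣x , ∣-trans d∣m m∣n)

coprime-+-self⇔ : ∀ {m x} → Coprime (m + x) m ⇔ Coprime x m
coprime-+-self⇔ {m} {x} = mk⇔ to coprime-+
  where
  to : Coprime (m + x) m → Coprime x m
  to c (d∣x , d∣m) = c (∣m∣n⇒∣m+n d∣m d∣x , d∣m)

∤-prime⇒coprime : ∀ {p x} → Prime p → ¬ p ∣ x → Coprime x p
∤-prime⇒coprime pr p∤x (d∣x , d∣p) with prime⇒irreducible pr d∣p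
... | inj₁ d≡1  = d≡1
... | inj₂ refl = ⊥-elim (p∤x d∣x)

coprime∧prime∣⇒∤ : ∀ {p x n} → Prime p → Coprime x n → p ∣ n → ¬ p ∣ x
coprime∧prime∣⇒∤ pr c p∣n p∣x = ¬prime[1] (subst Prime (c (p∣x , p∣n)) pr)

coprime-prime*⇔ : ∀ {p x m} → Prime p → Coprime x (p * m) ⇔ (Coprime x m × ¬ p ∣ x)
coprime-prime*⇔ {p} {x} {m} pr = mk⇔ to from
  where
  to : Coprime x (p * m) → Coprime x m × ¬ p ∣ x
  to c = coprime-∣ʳ c (n∣m*n p) , coprime∧prime∣⇒∤ pr c (m∣m*n m)
  from : Coprime x m × ¬ p ∣ x → Coprime x (p * m)
  from (c , p∤x) (d∣x , d∣pm) = c (d∣x , coprime-divisor (coprime-∣ˡ (∤-prime⇒coprime pr p∤x) d∣x) d∣pm)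

coprime-*prime⇔ : ∀ {p t m} → Prime p → ¬ p ∣ m → Coprime (p * t) m ⇔ Coprime t m
coprime-*prime⇔ {p} {t} {m} pr p∤m = mk⇔ to from
  where
  to : Coprime (p * t) m → Coprime t m
  to c = coprime-∣ˡ c (n∣m*n p)
  from : Coprime t m → Coprime (p * t) m
  from c (d∣pt , d∣m) = c (coprime-divisor (coprime-∣ˡ (∤-prime⇒coprime pr p∤m) d∣m) d∣pt , d∣m)

coprimeTo : ℕ → ℕ → Bool
coprimeTo n x = does (coprime? x n)

coprimeTo-⇔ : ∀ {n m} x y → (Coprime x n ⇔ Coprime y m) → coprimeTo n x ≡ coprimeTo m y
coprimeTo-⇔ {n} {m} x y e = does-⇔ e (coprime? x n) (coprime? y m)

length-filter-applyUpTo : ∀ {P : ℕ → Set} (P? : Decidable P) f N →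
                          length (filter P? (applyUpTo f N)) ≡ count (does ∘ P? ∘ f) N
length-filter-applyUpTo P? f zero = refl
length-filter-applyUpTo P? f (suc N) with does (P? (f 0))
... | true  = cong suc (length-filter-applyUpTo P? (f ∘ suc) N)
... | false = length-filter-applyUpTo P? (f ∘ suc) N

φ-count : ∀ n → φ n ≡ count (coprimeTo n ∘ suc) n
φ-count n = begin
  length (filter (λ x → gcd x n ≟ 1) (map suc (upTo n)))     ≡⟨ cong (length ∘ filter _) (map-upTo suc n) ⟩
  length (filter (λ x → gcd x n ≟ 1) (applyUpTo suc n))      ≡⟨ length-filter-applyUpTo _ suc n ⟩
  count (λ i → does (gcd (suc i) n ≟ 1)) n                   ≡⟨ count-cong (λ i → gcd≡1⇔coprime (suc i)) n ⟩
  count (coprimeTo n ∘ suc) n                                ∎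
  where
  open ≡-Reasoning
  gcd≡1⇔coprime : ∀ x → does (gcd x n ≟ 1) ≡ coprimeTo n x
  gcd≡1⇔coprime x = does-⇔ (mk⇔ gcd≡1⇒coprime coprime⇒gcd≡1) (gcd x n ≟ 1) (coprime? x n)

count-coprime-periodic : ∀ m j → count (coprimeTo m ∘ suc) (j * m) ≡ j * φ m
count-coprime-periodic m j = begin
  count (coprimeTo m ∘ suc) (j * m)  ≡⟨ count-periodic _ m period j ⟩
  j * count (coprimeTo m ∘ suc) m    ≡⟨ cong (j *_) (φ-count m) ⟨
  j * φ m                            ∎
  where
  open ≡-Reasoning
  period : ∀ i → coprimeTo m (suc (m + i)) ≡ coprimeTo m (suc i)
  period i = trans (cong (coprimeTo m) (sym (+-suc m i))) (coprimeTo-⇔ {m} {m} (m + suc i) (suc i) coprime-+-self⇔)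

φ-prime*-∣ : ∀ {p m} → Prime p → p ∣ m → φ (p * m) ≡ p * φ m
φ-prime*-∣ {p} {m} pr p∣m = begin
  φ (p * m)                                ≡⟨ φ-count (p * m) ⟩
  count (coprimeTo (p * m) ∘ suc) (p * m)  ≡⟨ count-cong (λ i → coprimeTo-⇔ (suc i) (suc i) coprime-by-m) (p * m) ⟩
  count (coprimeTo m ∘ suc) (p * m)        ≡⟨ count-coprime-periodic m p ⟩
  p * φ m                                  ∎
  where
  open ≡-Reasoning
  coprime-by-m : ∀ {x} → Coprime x (p * m) ⇔ Coprime x m
  coprime-by-m = mk⇔ (proj₁ ∘ Equivalence.to (coprime-prime*⇔ pr))
                            (λ c → Equivalence.from (coprime-prime*⇔ pr) (c , coprime∧prime∣⇒∤ pr c p∣m))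

-- Of the x ∈ [1, p m] coprime to m, the multiples of p are the p y with y ∈ [1, m] coprime
-- to m, and the others are exactly those coprime to p m.
φ-prime*-∤ : ∀ {q m} → Prime (suc q) → ¬ suc q ∣ m → φ (suc q * m) ≡ q * φ m
φ-prime*-∤ {q} {m} pr p∤m = +-cancelˡ-≡ (φ m) _ _ (sym (begin
  φ m + q * φ m                                     ≡⟨ count-coprime-periodic m p ⟨
  count (coprimeTo m ∘ suc) (p * m)                 ≡⟨ count-partition _ (λ i → does (p ∣? suc i)) (p * m) ⟩
  count multiples (p * m) + count others (p * m)    ≡⟨ cong₂ _+_ count-multiples≡φ count-others≡φ ⟩
  φ m + φ (p * m)                                   ∎))
  where
  open ≡-Reasoning
  p = suc q
  multiples others : ℕ → Bool
  multiples i = coprimeTo m (suc i) ∧ does (p ∣? suc i)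
  others    i = coprimeTo m (suc i) ∧ not (does (p ∣? suc i))
  coprime-p* : ∀ {y} → Coprime (p * y) m ⇔ Coprime y m
  coprime-p* = coprime-*prime⇔ pr p∤m
  count-multiples≡φ : count multiples (p * m) ≡ φ m
  count-multiples≡φ = begin
    count multiples (p * m)                   ≡⟨ count-multiples q (coprimeTo m) m ⟩
    count (λ i → coprimeTo m (p * suc i)) m   ≡⟨ count-cong (λ i → coprimeTo-⇔ (p * suc i) (suc i) coprime-p*) m ⟩
    count (coprimeTo m ∘ suc) m               ≡⟨ φ-count m ⟨
    φ m                                       ∎
  count-others≡φ : count others (p * m) ≡ φ (p * m)
  count-others≡φ = begin
    count others (p * m)                      ≡⟨ count-cong (λ i → sym (coprime-split (suc i))) (p * m) ⟩
    count (coprimeTo (p * m) ∘ suc) (p * m)   ≡⟨ φ-count (p * m) ⟨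
    φ (p * m)                                 ∎
    where
    coprime-split : ∀ x → coprimeTo (p * m) x ≡ coprimeTo m x ∧ not (does (p ∣? x))
    coprime-split x = does-⇔ (coprime-prime*⇔ pr) (coprime? x (p * m)) (coprime? x m ×-dec ¬? (p ∣? x))

odd-1 : Odd 1
odd-1 2∣1 with ∣⇒≤ 2∣1
... | s≤s ()

even⊎even-suc : ∀ n → 2 ∣ n ⊎ 2 ∣ suc n
even⊎even-suc zero    = inj₁ (divides 0 refl)
even⊎even-suc (suc n) with even⊎even-suc n
... | inj₁ 2∣n  = inj₂ (∣m∣n⇒∣m+n (∣-refl {2}) 2∣n)
... | inj₂ 2∣1+n = inj₁ 2∣1+n

odd-suc⇒even : ∀ {n} → Odd (suc n) → 2 ∣ n
odd-suc⇒even {n} odd with even⊎even-suc n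
... | inj₁ 2∣n   = 2∣n
... | inj₂ 2∣1+n = ⊥-elim (odd 2∣1+n)

odd-*⇒even : ∀ {x y} → Odd x → 2 ∣ x * y → 2 ∣ y
odd-*⇒even {x} {y} odd 2∣xy with euclidsLemma x y prime[2] 2∣xy
... | inj₁ 2∣x = ⊥-elim (odd 2∣x)
... | inj₂ 2∣y = 2∣y

odd-* : ∀ {x y} → Odd x → Odd y → Odd (x * y)
odd-* odd-x odd-y = odd-y ∘ odd-*⇒even odd-x

odd-3 : Odd 3
odd-3 2∣3 = odd-1 (∣m+n∣m⇒∣n {2} {2} {1} 2∣3 ∣-refl)

odd-3^ : ∀ a → Odd (3 ^ a)
odd-3^ zero    = odd-1
odd-3^ (suc a) = odd-* odd-3 (odd-3^ a)

odd-2*+1 : ∀ t → Odd (2 * t + 1)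
odd-2*+1 t 2∣2t+1 = odd-1 (∣m+n∣m⇒∣n 2∣2t+1 (m∣m*n t))

prime⇒2≤ : ∀ {p} → Prime p → 2 ≤ p
prime⇒2≤ {p} pr = nonTrivial⇒n>1 p {{prime⇒nonTrivial pr}}

oddPrime⇒3≤ : ∀ {p} → Prime p → Odd p → 3 ≤ p
oddPrime⇒3≤ {suc (suc zero)} pr odd = ⊥-elim (odd ∣-refl)
oddPrime⇒3≤ {suc (suc (suc _))} pr odd = s≤s (s≤s (s≤s z≤n))
oddPrime⇒3≤ {0}                 pr odd with () ← prime⇒2≤ pr
oddPrime⇒3≤ {1}                 pr odd with s≤s () ← prime⇒2≤ pr

-- Weight n v expresses F n = v.
data Weight : ℕ → ℕ → Set where
  weight-1  : Weight 1 0
  weight-2* : ∀ {m a} → Weight m a → Weight (2 * m) (suc a)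
  weight-p* : ∀ {q b m a} → Prime (suc q) → Odd (suc q) → Weight q b → Weight m a → Weight (suc q * m) (b + a)

weight⇒1≤ : ∀ {n v} → Weight n v → 1 ≤ n
weight⇒1≤ weight-1                        = s≤s z≤n
weight⇒1≤ (weight-2* {m} w)               = ≤-trans (weight⇒1≤ w) (m≤n*m m 2)
weight⇒1≤ (weight-p* {q} {m = m} _ _ _ w) = ≤-trans (weight⇒1≤ w) (m≤n*m m (suc q))

weight-* : ∀ {x a y b} → Weight x a → Weight y b → Weight (x * y) (a + b)
weight-* {y = y} {b = b} weight-1 w = subst (λ z → Weight z b) (sym (*-identityˡ y)) w
weight-* {y = y} {b = b} (weight-2* {m} {a} v) w =
  subst (λ z → Weight z (suc (a + b))) (sym (*-assoc 2 m y)) (weight-2* (weight-* v w))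
weight-* {y = y} {b = b′} (weight-p* {q} {b} {m} {a} pr odd wq v) w =
  subst₂ Weight (sym (*-assoc (suc q) m y)) (sym (+-assoc b a b′)) (weight-p* pr odd wq (weight-* v w))

weight-oddPrime : ∀ {q b} → Prime (suc q) → Odd (suc q) → Weight q b → Weight (suc q) b
weight-oddPrime {q} {b} pr odd w = subst₂ Weight (*-identityʳ (suc q)) (+-identityʳ b) (weight-p* pr odd w weight-1)

weight-1⇒0 : ∀ {n w} → Weight n w → n ≡ 1 → w ≡ 0
weight-1⇒0 weight-1 _ = refl
weight-1⇒0 (weight-2* {m} _) 2m≡1 = ⊥-elim (odd-1 (subst (2 ∣_) 2m≡1 (m∣m*n m)))
weight-1⇒0 (weight-p* {q} {m = m} pr _ _ _) pm≡1 =
  ⊥-elim (<⇒≢ (prime⇒2≤ pr) (sym (∣1⇒≡1 (subst (suc q ∣_) pm≡1 (m∣m*n m)))))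

module _ {n : ℕ} (rec : ∀ {q} → q < n → 1 ≤ q → Σ ℕ (Weight q)) where

  weight-prime : ∀ {p} → Prime p → p ≤ n → Σ ℕ (Weight p)
  weight-prime {p} pr p≤n with 2 ∣? p
  ... | yes 2∣p with prime⇒irreducible pr 2∣p
  ...   | inj₂ refl = 1 , weight-2* weight-1
  weight-prime {suc q} pr p≤n | no odd with s≤s 1≤q ← prime⇒2≤ pr =
    let b , w = rec (<-≤-trans (n<1+n q) p≤n) 1≤q in b , weight-oddPrime pr odd w

  weight-product : ∀ {ps} → All Prime ps → product ps ≤ n → Σ ℕ (Weight (product ps))
  weight-product []                 _  = 0 , weight-1
  weight-product {p ∷ ps} (pr ∷ prs) ≤n =
    let a , wp = weight-prime pr (≤-trans (m≤m*n p (product ps) {{>-nonZero (productOfPrimes≥1 prs)}}) ≤n)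
        b , wm = weight-product prs (≤-trans (m≤n*m (product ps) p {{prime⇒nonZero pr}}) ≤n)
    in a + b , weight-* wp wm

weight-total : ∀ n → 1 ≤ n → Σ ℕ (Weight n)
weight-total = <-rec _ λ n rec 1≤n →
  let open PrimeFactorisation (factorise n {{>-nonZero 1≤n}})
  in subst (Σ ℕ ∘ Weight) (sym isFactorisation)
           (weight-product rec factorsPrime (≤-reflexive (sym isFactorisation)))

weight-φ : ∀ {n v} → Weight n v → Σ ℕ λ w → Weight (φ n) w × (2 ∣ n → suc w ≡ v) × (Odd n → w ≡ v)
weight-φ weight-1 = 0 , weight-1 , ⊥-elim ∘ odd-1 , λ _ → refl
weight-φ (weight-2* {m} wm) with weight-φ wm | 2 ∣? m
... | w , wφ , even , _   | yes 2∣m =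
  suc w , subst (λ x → Weight x (suc w)) (sym (φ-prime*-∣ prime[2] 2∣m)) (weight-2* wφ) ,
  (λ _ → cong suc (even 2∣m)) , (λ odd → ⊥-elim (odd (m∣m*n m)))
... | w , wφ , _   , odd-m | no odd =
  w , subst (λ x → Weight x w) (sym (trans (φ-prime*-∤ prime[2] odd) (*-identityˡ _))) wφ ,
  (λ _ → cong suc (odd-m odd)) , (λ odd → ⊥-elim (odd (m∣m*n m)))
weight-φ (weight-p* {q} {b} {m} {a} pr odd wq wm) with weight-φ wm
... | w , wφ , even , odd-m = b + w , weight-φ-p*m , even-case , odd-case
  where
  p = suc q
  weight-φ-p*m : Weight (φ (p * m)) (b + w)
  weight-φ-p*m with p ∣? m
  ... | yes p∣m = subst (λ x → Weight x (b + w)) (sym (φ-prime*-∣ pr p∣m)) (weight-* (weight-oddPrime pr odd wq) wφ)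
  ... | no p∤m  = subst (λ x → Weight x (b + w)) (sym (φ-prime*-∤ pr p∤m)) (weight-* wq wφ)
  even-case : 2 ∣ p * m → suc (b + w) ≡ b + a
  even-case 2∣pm = trans (sym (+-suc b w)) (cong (b +_) (even (odd-*⇒even odd 2∣pm)))
  odd-case : Odd (p * m) → b + w ≡ b + a
  odd-case odd-pm = cong (b +_) (odd-m (λ 2∣m → odd-pm (∣-trans 2∣m (n∣m*n p))))

φ-< : ∀ {n} → 2 ≤ n → φ n < n
φ-< {suc n} 2≤n = begin-strict
  φ (suc n)                                            ≡⟨ φ-count (suc n) ⟩
  count Q (suc n)                                      ≡⟨ count-suc Q n ⟩
  count Q n + indicator (coprimeTo (suc n) (suc n))    ≡⟨ cong (λ b → count Q n + indicator b) not-coprime ⟩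
  count Q n + 0                                        ≡⟨ +-identityʳ _ ⟩
  count Q n                                            ≤⟨ count-≤ Q n ⟩
  n                                                    <⟨ n<1+n n ⟩
  suc n                                                ∎
  where
  open ≤-Reasoning
  Q = coprimeTo (suc n) ∘ suc
  not-coprime : coprimeTo (suc n) (suc n) ≡ false
  not-coprime = dec-false (coprime? _ _) (λ c → <⇒≢ 2≤n (sym (c (∣-refl , ∣-refl))))

weight⇒φ-even : ∀ {n v} → Weight n v → 3 ≤ n → 2 ∣ φ n
weight⇒φ-even weight-1 (s≤s ())
weight⇒φ-even (weight-2* {m} wm) 3≤2m with 2 ∣? m
... | yes 2∣m = subst (2 ∣_) (sym (φ-prime*-∣ prime[2] 2∣m)) (m∣m*n (φ m))
... | no odd  = subst (2 ∣_) (sym (trans (φ-prime*-∤ prime[2] odd) (*-identityˡ _)))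
                  (weight⇒φ-even wm (3≤m m 3≤2m odd))
  where
  3≤m : ∀ m → 3 ≤ 2 * m → Odd m → 3 ≤ m
  3≤m (suc (suc zero))    _ odd = ⊥-elim (odd ∣-refl)
  3≤m (suc (suc (suc _))) _ _   = s≤s (s≤s (s≤s z≤n))
  3≤m 0                   () _
  3≤m 1                   (s≤s (s≤s ())) _
weight⇒φ-even (weight-p* {q} {m = m} pr odd _ wm) _ with suc q ∣? m
... | yes p∣m = subst (2 ∣_) (sym (φ-prime*-∣ pr p∣m)) (∣-trans (weight⇒φ-even wm 3≤m) (n∣m*n (suc q)))
  where 3≤m = ≤-trans (oddPrime⇒3≤ pr odd) (∣⇒≤ {{>-nonZero (weight⇒1≤ wm)}} p∣m)
... | no p∤m  = subst (2 ∣_) (sym (φ-prime*-∤ pr p∤m)) (∣-trans (odd-suc⇒even odd) (m∣m*n (φ m)))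

φ-even : ∀ {n} → 3 ≤ n → 2 ∣ φ n
φ-even {n} 3≤n = weight⇒φ-even (proj₂ (weight-total n (≤-trans (s≤s z≤n) 3≤n))) 3≤n

Hfuel-stable : ∀ f g n → n ≤ f → n ≤ g → Hfuel f n ≡ Hfuel g n
Hfuel-stable zero    zero    n       _  _  = refl
Hfuel-stable zero    (suc g) .zero   z≤n _ = refl
Hfuel-stable (suc f) zero    .zero   _ z≤n = refl
Hfuel-stable (suc f) (suc g) n n≤f n≤g with n ≤? 1
... | yes _   = refl
... | no n≰1 = cong suc (Hfuel-stable f g (φ n) (≤-pred (≤-trans φn<n n≤f)) (≤-pred (≤-trans φn<n n≤g)))
  where φn<n = φ-< (≰⇒> n≰1)

H-suc : ∀ {n} → 2 ≤ n → H n ≡ suc (H (φ n))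
H-suc {suc n} 2≤n with suc n ≤? 1
... | yes n≤1 = ⊥-elim (<⇒≱ 2≤n n≤1)
... | no _    = cong suc (Hfuel-stable n (φ (suc n)) (φ (suc n)) (≤-pred (φ-< 2≤n)) ≤-refl)

H-weight : ∀ n {v} → 2 ≤ n → Weight n v → (2 ∣ n → H n ≡ v) × (Odd n → H n ≡ suc v)
H-weight = <-rec P step
  where
  P : ℕ → Set
  P n = ∀ {v} → 2 ≤ n → Weight n v → (2 ∣ n → H n ≡ v) × (Odd n → H n ≡ suc v)
  step : ∀ n → (∀ {m} → m < n → P m) → P n
  step n rec 2≤n wn with w , wφ , even , odd ← weight-φ wn =
    (λ 2∣n → trans Hn (even 2∣n)) , (λ odd-n → trans Hn (cong suc (odd odd-n)))
    where
    H-φ : H (φ n) ≡ w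
    H-φ with φ n ≤? 1
    ... | yes φn≤1 = trans (cong H φn≡1) (sym (weight-1⇒0 wφ φn≡1))
      where φn≡1 = ≤-antisym φn≤1 (weight⇒1≤ wφ)
    ... | no φn≰1  = proj₁ (rec (φ-< 2≤n) (≰⇒> φn≰1) wφ) (φ-even 3≤n)
      where
      3≤n : 3 ≤ n
      3≤n = ≤∧≢⇒< 2≤n (λ 2≡n → <⇒≱ (φ-< 2≤n) (subst (_≤ φ n) 2≡n (≰⇒> φn≰1)))
    Hn : H n ≡ suc w
    Hn = trans (H-suc 2≤n) (cong suc H-φ)

ratio-weaken : ∀ α β α′ β′ x y → .{{_ : NonZero α}} → α * x ≤ β * y → α′ * β ≤ β′ * α → α′ * x ≤ β′ * y
ratio-weaken α β α′ β′ x y h α′β≤β′α = *-cancelˡ-≤ α (begin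
  α * (α′ * x)   ≡⟨ *-swap α α′ x ⟩
  α′ * (α * x)   ≤⟨ *-monoʳ-≤ α′ h ⟩
  α′ * (β * y)   ≡⟨ *-assoc α′ β y ⟨
  (α′ * β) * y   ≤⟨ *-monoˡ-≤ y α′β≤β′α ⟩
  (β′ * α) * y   ≡⟨ cong (_* y) (*-comm β′ α) ⟩
  (α * β′) * y   ≡⟨ *-assoc α β′ y ⟩
  α * (β′ * y)   ∎)
  where open ≤-Reasoning

ratio-*ˡ : ∀ c {α β x y} → α * x ≤ β * y → α * (c * x) ≤ β * (c * y)
ratio-*ˡ c {α} {β} {x} {y} h = subst₂ _≤_ (*-swap c α x) (*-swap c β y) (*-monoʳ-≤ c h)

-- Outside the three explicit families n ≤ (2/3)·3^v, and n ≤ (14/27)·3^v for even n; the even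
-- bound is needed because the weight of an odd prime p is that of the even number p - 1.
data Shape (n v : ℕ) : Set where
  pow3       : n ≡ 3 ^ v → Shape n v
  twice-pow3 : ∀ c → n ≡ 2 * 3 ^ c → v ≡ suc c → Shape n v
  pow3*P̂    : ∀ a c → 1 ≤ c → Prime (2 * 3 ^ c + 1) → n ≡ 3 ^ a * (2 * 3 ^ c + 1) → v ≡ a + suc c → Shape n v
  small      : 3 * n ≤ 2 * 3 ^ v → (2 ∣ n → 27 * n ≤ 14 * 3 ^ v) → Shape n v

P̂-ratio : ∀ c → 1 ≤ c → 9 * (2 * 3 ^ c + 1) ≤ 7 * 3 ^ suc c
P̂-ratio (suc c) _ = begin
  9 * (2 * (3 * t) + 1)  ≡⟨ e₁ t ⟩
  9 + 54 * t             ≤⟨ +-monoˡ-≤ (54 * t) (*-monoʳ-≤ 9 (m^n>0 3 c)) ⟩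
  9 * t + 54 * t         ≡⟨ e₂ t ⟩
  7 * (3 * (3 * t))      ∎
  where
  open ≤-Reasoning
  t = 3 ^ c
  e₁ : ∀ t → 9 * (2 * (3 * t) + 1) ≡ 9 + 54 * t
  e₁ = solve-∀
  e₂ : ∀ t → 9 * t + 54 * t ≡ 7 * (3 * (3 * t))
  e₂ = solve-∀

pow3*P̂-ratio : ∀ a c → 1 ≤ c → 9 * (3 ^ a * (2 * 3 ^ c + 1)) ≤ 7 * 3 ^ (a + suc c)
pow3*P̂-ratio a c 1≤c = begin
  9 * (3 ^ a * P)            ≡⟨ *-swap 9 (3 ^ a) P ⟩
  3 ^ a * (9 * P)            ≤⟨ *-monoʳ-≤ (3 ^ a) (P̂-ratio c 1≤c) ⟩
  3 ^ a * (7 * 3 ^ suc c)    ≡⟨ *-swap (3 ^ a) 7 _ ⟩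
  7 * (3 ^ a * 3 ^ suc c)    ≡⟨ cong (7 *_) (^-distribˡ-+-* 3 a (suc c)) ⟨
  7 * 3 ^ (a + suc c)        ∎
  where
  open ≤-Reasoning
  P = 2 * 3 ^ c + 1

shape-ratio : ∀ {n v} → Shape n v → n ≡ 3 ^ v ⊎ (9 * n ≤ 7 * 3 ^ v × (2 ∣ n → 3 * n ≤ 2 * 3 ^ v))
shape-ratio (pow3 n≡3^v) = inj₁ n≡3^v
shape-ratio (twice-pow3 c refl refl) =
  inj₂ (subst₂ _≤_ (*-assoc 9 2 t) (*-assoc 7 3 t) (*-monoˡ-≤ t (m≤m+n 18 3)) , λ _ → ≤-reflexive (*-swap 3 2 t))
  where t = 3 ^ c
shape-ratio (pow3*P̂ a c 1≤c _ refl refl) =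
  inj₂ (pow3*P̂-ratio a c 1≤c , λ 2∣n → ⊥-elim (odd-* (odd-3^ a) (odd-2*+1 (3 ^ c)) 2∣n))
shape-ratio {n} {v} (small 3n≤ _) = inj₂ (ratio-weaken 3 2 9 7 n (3 ^ v) 3n≤ (m≤m+n 18 3) , λ _ → 3n≤)

small-even : ∀ {n v} → 27 * n ≤ 14 * 3 ^ v → Shape n v
small-even {n} {v} 27n≤ = small (ratio-weaken 27 14 3 2 n (3 ^ v) 27n≤ (m≤m+n 42 12)) (λ _ → 27n≤)

data PrimeShape (p b : ℕ) : Set where
  prime-3     : p ≡ 3 → b ≡ 1 → PrimeShape p b
  prime-P̂     : ∀ c → 1 ≤ c → Prime (2 * 3 ^ c + 1) → p ≡ 2 * 3 ^ c + 1 → b ≡ suc c → PrimeShape p b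
  prime-small : 3 * p ≤ 2 * 3 ^ b → PrimeShape p b

ratio-suc : ∀ b q → 2 ≤ q → 27 * q ≤ 14 * 3 ^ b → 3 * suc q ≤ 2 * 3 ^ b
ratio-suc 0             q 2≤q 27q≤ = ⊥-elim (<⇒≱ (m≤m+n 15 39) (≤-trans (*-monoʳ-≤ 27 2≤q) 27q≤))
ratio-suc 1             q 2≤q 27q≤ = ⊥-elim (<⇒≱ (m≤m+n 43 11) (≤-trans (*-monoʳ-≤ 27 2≤q) 27q≤))
ratio-suc (suc (suc b)) q 2≤q 27q≤ = *-cancelˡ-≤ 9 (begin
  9 * (3 * suc q)               ≡⟨ e₁ q ⟩
  27 + 27 * q                   ≤⟨ +-mono-≤ (*-monoʳ-≤ 27 (m^n>0 3 b)) 27q≤ ⟩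
  27 * t + 14 * (3 * (3 * t))   ≡⟨ e₂ t ⟩
  153 * t                       ≤⟨ *-monoˡ-≤ t (m≤m+n 153 9) ⟩
  162 * t                       ≡⟨ e₃ t ⟩
  9 * (2 * (3 * (3 * t)))       ∎)
  where
  open ≤-Reasoning
  t = 3 ^ b
  e₁ : ∀ q → 9 * (3 * suc q) ≡ 27 + 27 * q
  e₁ = solve-∀
  e₂ : ∀ t → 27 * t + 14 * (3 * (3 * t)) ≡ 153 * t
  e₂ = solve-∀
  e₃ : ∀ t → 162 * t ≡ 9 * (2 * (3 * (3 * t)))
  e₃ = solve-∀

prime-shape : ∀ {q b} → Prime (suc q) → Odd (suc q) → Shape q b → PrimeShape (suc q) b
prime-shape {q} {b} pr odd q-shape = go q-shape
  where
  2∣q : 2 ∣ q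
  2∣q = odd-suc⇒even odd
  go : Shape q b → PrimeShape (suc q) b
  go (pow3 q≡3^b)               = ⊥-elim (odd-3^ b (subst (2 ∣_) q≡3^b 2∣q))
  go (twice-pow3 zero q≡2 refl) = prime-3 (cong suc q≡2) refl
  go (twice-pow3 (suc c) q≡ refl) = prime-P̂ (suc c) (s≤s z≤n) (subst Prime p≡ pr) p≡ refl
    where p≡ = trans (cong suc q≡) (+-comm 1 _)
  go (pow3*P̂ a c _ _ q≡ _)      = ⊥-elim (odd-* (odd-3^ a) (odd-2*+1 (3 ^ c)) (subst (2 ∣_) q≡ 2∣q))
  go (small _ even-bound)       = prime-small (ratio-suc b q 2≤q (even-bound 2∣q))
    where 2≤q = ∣⇒≤ {{>-nonZero (≤-pred (prime⇒2≤ pr))}} 2∣q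

ratio-*-3^ : ∀ {α₁ β₁ x₁ α₂ β₂ x₂} b a → α₁ * x₁ ≤ β₁ * 3 ^ b → α₂ * x₂ ≤ β₂ * 3 ^ a →
             (α₁ * α₂) * (x₁ * x₂) ≤ (β₁ * β₂) * 3 ^ (b + a)
ratio-*-3^ {α₁} {β₁} {x₁} {α₂} {β₂} {x₂} b a h₁ h₂ = begin
  (α₁ * α₂) * (x₁ * x₂)        ≡⟨ *-interchange α₁ α₂ x₁ x₂ ⟩
  (α₁ * x₁) * (α₂ * x₂)        ≤⟨ *-mono-≤ h₁ h₂ ⟩
  (β₁ * 3 ^ b) * (β₂ * 3 ^ a)  ≡⟨ *-interchange β₁ (3 ^ b) β₂ (3 ^ a) ⟩
  (β₁ * β₂) * (3 ^ b * 3 ^ a)  ≡⟨ cong ((β₁ * β₂) *_) (^-distribˡ-+-* 3 b a) ⟨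
  (β₁ * β₂) * 3 ^ (b + a)      ∎
  where open ≤-Reasoning

shape-prime* : ∀ {p b m a} → Odd p → PrimeShape p b → Shape m a → Shape (p * m) (b + a)
shape-prime* _ (prime-3 refl refl) (pow3 refl) = pow3 refl
shape-prime* _ (prime-3 refl refl) (twice-pow3 c refl refl) = twice-pow3 (suc c) (*-swap 3 2 (3 ^ c)) refl
shape-prime* _ (prime-3 refl refl) (pow3*P̂ a c 1≤c pr refl refl) =
  pow3*P̂ (suc a) c 1≤c pr (sym (*-assoc 3 (3 ^ a) _)) refl
shape-prime* {m = m} {a} _ (prime-3 refl refl) (small 3m≤ even-bound) =
  small (ratio-*ˡ 3 {3} {2} {m} {3 ^ a} 3m≤)
        (λ 2∣3m → ratio-*ˡ 3 {27} {14} {m} {3 ^ a} (even-bound (odd-*⇒even odd-3 2∣3m)))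
shape-prime* {p} {b} {m} {a} odd (prime-P̂ c 1≤c pr refl refl) m-shape with shape-ratio m-shape
... | inj₁ refl = pow3*P̂ a c 1≤c pr (*-comm p (3 ^ a)) (+-comm (suc c) a)
... | inj₂ (9m≤ , even-bound) = small
  (ratio-weaken 81 49 3 2 (p * m) (3 ^ (b + a))
     (ratio-*-3^ {9} {7} {p} {9} {7} {m} b a (P̂-ratio c 1≤c) 9m≤) (m≤m+n 147 15))
  (λ 2∣pm → ratio-*-3^ {9} {7} {p} {3} {2} {m} b a (P̂-ratio c 1≤c) (even-bound (odd-*⇒even odd 2∣pm)))
shape-prime* {p} {b} {m} {a} odd (prime-small 3p≤) m-shape with shape-ratio m-shape
... | inj₁ refl = small (ratio-*-3^ {3} {2} {p} {1} {1} {3 ^ a} b a 3p≤ ≤-refl)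
                        (λ 2∣p3^a → ⊥-elim (odd-3^ a (odd-*⇒even odd 2∣p3^a)))
... | inj₂ (9m≤ , _) = small-even (ratio-*-3^ {3} {2} {p} {9} {7} {m} b a 3p≤ 9m≤)

weight⇒shape : ∀ {n v} → Weight n v → Shape n v
weight⇒shape weight-1 = pow3 refl
weight⇒shape (weight-2* {m} {a} wm) with shape-ratio (weight⇒shape wm)
... | inj₁ m≡3^a     = twice-pow3 a (cong (2 *_) m≡3^a) refl
... | inj₂ (9m≤ , _) = small-even (subst₂ _≤_ (e₁ m) (e₂ (3 ^ a)) (*-monoʳ-≤ 6 9m≤))
  where
  e₁ : ∀ m → 6 * (9 * m) ≡ 27 * (2 * m)
  e₁ = solve-∀
  e₂ : ∀ t → 6 * (7 * t) ≡ 14 * (3 * t)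
  e₂ = solve-∀
weight⇒shape (weight-p* pr odd wq wm) = shape-prime* odd (prime-shape pr odd (weight⇒shape wq)) (weight⇒shape wm)

prime[3] : Prime 3
prime[3] = toWitness {a? = prime? 3} _

weight-3^ : ∀ a → Weight (3 ^ a) a
weight-3^ zero    = weight-1
weight-3^ (suc a) = weight-* (weight-oddPrime prime[3] odd-3 (weight-2* weight-1)) (weight-3^ a)

weight-P̂ : ∀ c → Prime (2 * 3 ^ c + 1) → Weight (2 * 3 ^ c + 1) (suc c)
weight-P̂ c pr = subst (λ p → Weight p (suc c)) (+-comm 1 _)
  (weight-oddPrime (subst Prime (+-comm _ 1) pr) (subst Odd (+-comm _ 1) (odd-2*+1 (3 ^ c))) (weight-2* (weight-3^ c)))

H-P̂ : ∀ c → Prime (2 * 3 ^ c + 1) → H (2 * 3 ^ c + 1) ≡ suc (suc c)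
H-P̂ c pr = proj₂ (H-weight _ (prime⇒2≤ pr) (weight-P̂ c pr)) (odd-2*+1 (3 ^ c))

P̂-form : ∀ {p} → P̂ p → Σ ℕ λ c → Prime (2 * 3 ^ c + 1) × p ≡ 2 * 3 ^ c + 1
P̂-form (pr , _ , s≤s (s≤s {n = c} _) , refl) = c , pr , refl

val-P̂ : ∀ k c → Prime (2 * 3 ^ c + 1) → H (2 * 3 ^ c + 1) ≤ k →
        val k (2 * 3 ^ c + 1) ≡ 2 * 3 ^ (k ∸ 2) + 3 ^ (k ∸ suc (suc c))
val-P̂ k c pr H≤k rewrite H-P̂ c pr = begin
  3 ^ e * (2 * 3 ^ c + 1)      ≡⟨ distrib (3 ^ e) (3 ^ c) ⟩
  2 * (3 ^ e * 3 ^ c) + 3 ^ e  ≡⟨ cong (λ t → 2 * t + 3 ^ e) (^-distribˡ-+-* 3 e c) ⟨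
  2 * 3 ^ (e + c) + 3 ^ e      ≡⟨ cong (λ t → 2 * 3 ^ t + 3 ^ e) (e+c≡k∸2 k H≤k) ⟩
  2 * 3 ^ (k ∸ 2) + 3 ^ e      ∎
  where
  open ≡-Reasoning
  e = k ∸ suc (suc c)
  distrib : ∀ s t → s * (2 * t + 1) ≡ 2 * (s * t) + s
  distrib = solve-∀
  e+c≡k∸2 : ∀ k → suc (suc c) ≤ k → k ∸ suc (suc c) + c ≡ k ∸ 2
  e+c≡k∸2 (suc (suc k)) (s≤s (s≤s c≤k)) = m∸n+n≡m c≤k

P̂-val-in-C : ∀ k p → P̂ p → H p ≤ k → Odd (val k p) × C k (val k p)
P̂-val-in-C k _ p̂ H≤k with c , pr , refl ← P̂-form p̂ rewrite H-P̂ c pr = odd-n , ≤-trans (s≤s z≤n) 2≤n , H-n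
  where
  P = 2 * 3 ^ c + 1
  e = k ∸ suc (suc c)
  odd-n : Odd (3 ^ e * P)
  odd-n = odd-* (odd-3^ e) (odd-2*+1 (3 ^ c))
  2≤n : 2 ≤ 3 ^ e * P
  2≤n = ≤-trans (prime⇒2≤ pr) (m≤n*m P (3 ^ e) {{m^n≢0 3 e}})
  H-n : H (3 ^ e * P) ≡ k
  H-n = begin
    H (3 ^ e * P)         ≡⟨ proj₂ (H-weight _ 2≤n (weight-* (weight-3^ e) (weight-P̂ c pr))) odd-n ⟩
    suc (e + suc c)       ≡⟨ +-suc e (suc c) ⟨
    e + suc (suc c)       ≡⟨ m∸n+n≡m H≤k ⟩
    k                     ∎
    where open ≡-Reasoning

val-P̂-decreasing : ∀ k p q → P̂ p → P̂ q → H p ≤ k → H q ≤ k → p < q → val k q < val k p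
val-P̂-decreasing k _ _ p̂ q̂ Hp≤k Hq≤k p<q with c , pr , refl ← P̂-form p̂ | d , pr′ , refl ← P̂-form q̂
  rewrite val-P̂ k c pr Hp≤k | val-P̂ k d pr′ Hq≤k =
  +-monoʳ-< (2 * 3 ^ (k ∸ 2)) (^-monoʳ-< 3 (s≤s (s≤s z≤n)) (∸-monoʳ-< (s≤s (s≤s c<d)) d+2≤k))
  where
  d+2≤k : suc (suc d) ≤ k
  d+2≤k = subst (_≤ k) (H-P̂ d pr′) Hq≤k
  c<d : c < d
  c<d = ≰⇒> (λ d≤c → <⇒≱ p<q (+-monoˡ-≤ 1 (*-monoʳ-≤ 2 (^-monoʳ-≤ 3 d≤c))))

Listed : ℕ → ℕ → Set
Listed k n = Σ ℕ λ p → P̂ p × H p ≤ k × n ≡ val k p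

BelowListed : ℕ → ℕ → Set
BelowListed k n = (q : ℕ) → P̂ q → H q ≤ k → n < val k q

odd-shape⇒listed⊎below : ∀ {n v} → 1 ≤ v → Odd n → Shape n v → Listed (suc v) n ⊎ BelowListed (suc v) n
odd-shape⇒listed⊎below _ odd (twice-pow3 c refl _) = ⊥-elim (odd (m∣m*n (3 ^ c)))
odd-shape⇒listed⊎below _ _ (pow3*P̂ a c _ pr refl refl) =
  inj₁ (2 * 3 ^ c + 1 , (pr , suc (suc c) , s≤s (s≤s z≤n) , refl) ,
        subst (_≤ suc (a + suc c)) (sym H-p) (s≤s (m≤n+m (suc c) a)) ,
        cong (λ h → 3 ^ h * (2 * 3 ^ c + 1)) (sym (trans (cong (suc (a + suc c) ∸_) H-p) (m+n∸n≡m a (suc c)))))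
  where H-p = H-P̂ c pr
odd-shape⇒listed⊎below {v = suc v} _ _ (pow3 refl) =
  inj₁ (3 , (prime[3] , 2 , ≤-refl , refl) , s≤s (s≤s z≤n) , *-comm 3 (3 ^ v))
odd-shape⇒listed⊎below {n} {suc v} _ _ (small 3n≤ _) = inj₂ below
  where
  n≤ : n ≤ 2 * 3 ^ v
  n≤ = *-cancelˡ-≤ 3 (subst (3 * n ≤_) (*-swap 2 3 (3 ^ v)) 3n≤)
  below : BelowListed (suc (suc v)) n
  below q q̂ Hq≤ with d , pr , refl ← P̂-form q̂ rewrite val-P̂ (suc (suc v)) d pr Hq≤ =
    ≤-<-trans n≤ (m<m+n _ (m^n>0 3 (suc (suc v) ∸ suc (suc d))))

odd-C⇒listed⊎below : ∀ k → 2 ≤ k → (n : ℕ) → Odd n → C k n → Listed k n ⊎ BelowListed k n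
odd-C⇒listed⊎below k       2≤k  zero    _   (() , _)
odd-C⇒listed⊎below .0      ()   1       _   (_ , refl)
odd-C⇒listed⊎below k       2≤k  n@(suc (suc _)) odd (_ , Hn≡k)
  with v , wn ← weight-total n (s≤s z≤n)
  with refl ← trans (sym (proj₂ (H-weight n (s≤s (s≤s z≤n)) wn) odd)) Hn≡k =
  odd-shape⇒listed⊎below (≤-pred 2≤k) odd (weight⇒shape wn)

corollary3p5 : (k : ℕ) → 2 < k →
      ((p : ℕ) → P̂ p → H p ≤ k → Odd (val k p) × C k (val k p))
    × ((p q : ℕ) → P̂ p → P̂ q → H p ≤ k → H q ≤ k → p < q → val k q < val k p)
    × ((n : ℕ) → Odd n → C k n →
         Σ ℕ (λ p → P̂ p × H p ≤ k × n ≡ val k p)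
         ⊎ ((q : ℕ) → P̂ q → H q ≤ k → n < val k q))
corollary3p5 k 2<k =
  P̂-val-in-C k , val-P̂-decreasing k , odd-C⇒listed⊎below k (<⇒≤ 2<k)
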